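{- Let $n = p_1^{k_1} p_2^{k_2} \cdots p_r^{k_r}$ be the prime factorization of a positive integer $n$, with distinct primes $p_i$ and integers $k_i \ge 1$, and let $D = \prod_{i=1}^r (k_i+1)$ be the number of divisors of $n$. Then the Schultz index of the divisor prime graph $G_{Dp(n)}$ is $$S(G_{Dp(n)}) = 2(D-1)\prod_{i=1}^r (2k_i+1) - \prod_{i=1}^r \left( (k_i+1)^2 + k_i \right) + 1.$$
   Context: For a positive integer $n$, the divisor prime graph $G_{Dp(n)}$ is the simple graph whose vertex set is the set of positive divisors of $n$, in which two distinct vertices $x, y$ are adjacent if and only if $\gcd(x,y) = 1$ (no loops). For a connected graph $G$ with degree function $d(\cdot)$ and shortest-path distance $d(u,v)$, the Schultz index is $S(G) = \sum_{\{u,v\}} (d(u)+d(v))\,d(u,v)$, summed over all unordered pairs of distinct vertices. -}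

module Defs where

open import Data.Bool using (T?; Bool; true; false; _∧_; _∨_; not; if_then_else_)
open import Data.Nat using (ℕ; zero; suc; _+_; _*_; _∸_; _^_; _≡ᵇ_; _≤_)
open import Data.Nat.Divisibility using (_∣?_)
open import Data.Nat.GCD using (gcd)
open import Data.Nat.Primality using (Prime)
open import Data.List using (List; []; _∷_; map; filter; length; upTo; _++_)
open import Data.Nat.ListAction using (sum; product)
open import Data.Bool.ListAction using (any)
open import Data.List.Relation.Unary.All using (All)
open import Data.List.Relation.Unary.AllPairs using (AllPairs)
open import Data.Product using (_×_; _,_; proj₁; proj₂)
open import Relation.Binary.PropositionalEquality using (_≢_; _≡_)

divisors : ℕ → List ℕ
divisors n = filter (λ d → d ∣? n) (map suc (upTo n))

adj : ℕ → ℕ → Bool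
adj x y = not (x ≡ᵇ y) ∧ (gcd x y ≡ᵇ 1)

deg : ℕ → ℕ → ℕ
deg n x = length (filter (λ y → T? (adj x y)) (divisors n))


-- reach V k u v : there is a walk of length ≤ k from u to v in the graph on V
reach : List ℕ → ℕ → ℕ → ℕ → Bool
reach V zero    u v = u ≡ᵇ v
reach V (suc k) u v = reach V k u v ∨ any (λ w → reach V k u w ∧ adj w v) V

-- least k with k ≤ bound, starting the search at i, such that reach V k u v
-- (returns 0 if no such k exists; never happens for connected graphs)
firstReach : List ℕ → ℕ → ℕ → ℕ → ℕ → ℕ
firstReach V i zero      u v = if reach V i u v then i else 0
firstReach V i (suc b)   u v = if reach V i u v then i else firstReach V (suc i) b u v

-- shortest-path distance in G_Dp(n) (shortest paths have length ≤ #vertices)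
dist : ℕ → ℕ → ℕ → ℕ
dist n u v = firstReach (divisors n) 0 (length (divisors n)) u v

pairs : {A : Set} → List A → List (A × A)
pairs []       = []
pairs (x ∷ xs) = map (λ y → (x , y)) xs ++ pairs xs

schultz : ℕ → ℕ
schultz n = sum (map (λ p → (deg n (proj₁ p) + deg n (proj₂ p)) * dist n (proj₁ p) (proj₂ p))
                     (pairs (divisors n)))

IsFactorization : ℕ → List (ℕ × ℕ) → Set
IsFactorization n fs =
  All (λ pk → Prime (proj₁ pk)) fs ×
  All (λ pk → 1 ≤ proj₂ pk) fs ×
  AllPairs (λ a b → proj₁ a ≢ proj₁ b) fs ×
  (n ≡ product (map (λ pk → proj₁ pk ^ proj₂ pk) fs))

module Submission where

-- The divisor 1 is adjacent to every other divisor, so the graph has diameter at most 2 and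
-- d(u,v) = 2 − [u ~ v] for u ≠ v.  Grouping the Schultz sum by vertices gives
-- S = Σ_u deg(u)·Tr(u) with transmission Tr(u) = 2(D − 1) − deg(u), that is
-- S = 2(D − 1)·Σ deg − Σ deg².  If c(u) counts the divisors coprime to u, then
-- deg(u) = c(u) − [u = 1], which turns both sums into A = Σ_u c(u) and B = Σ_u c(u)²
-- and yields S = 2(D − 1)A − B + 1.  Since a divisor of a coprime product ab factors
-- uniquely as xy with x ∣ a, y ∣ b, and coprimality splits along such factorisations,
-- D, A and B are multiplicative; at p^k they are k + 1, 2k + 1 and (k + 1)² + k,
-- because 1 is coprime to all k + 1 divisors while p^i (i ≥ 1) is coprime to 1 only.

open import Defs
open import Data.Nat using (ℕ; suc; _+_; _*_; _∸_)
open import Data.List using (List; map)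
open import Data.Nat.ListAction using (product)
open import Data.Product using (_×_; proj₁; proj₂)
open import Relation.Binary.PropositionalEquality using (_≡_)

open import Data.Bool using (Bool; true; false; T; T?; not; _∧_)
open import Data.Bool.Properties using (T-∨; T-∧; T-≡; ¬-not)
open import Data.List using ([]; _∷_; _++_; length; filter; upTo; applyUpTo; cartesianProduct)
open import Data.List.Membership.Propositional using (_∈_; find; lose)
open import Data.List.Membership.Propositional.Properties
  using (∈-++⁻; ∈-map⁺; ∈-map⁻; ∈-filter⁺; ∈-filter⁻; ∈-upTo⁺; ∈-applyUpTo⁺; ∈-applyUpTo⁻;
         ∈-cartesianProduct⁺; ∈-cartesianProduct⁻)
open import Data.List.Membership.Propositional.Properties.WithK using (unique∧set⇒bag)
open import Data.List.Properties using (length-applyUpTo)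
open import Data.List.Relation.Binary.BagAndSetEquality using (∼bag⇒↭)
open import Data.List.Relation.Binary.Permutation.Propositional using (_↭_)
open import Data.List.Relation.Binary.Permutation.Propositional.Properties using (map⁺)
open import Data.List.Relation.Unary.All as All using (All; []; _∷_)
open import Data.List.Relation.Unary.All.Properties using () renaming (map⁺ to All-map⁺)
open import Data.List.Relation.Unary.AllPairs using ([]; _∷_)
open import Data.List.Relation.Unary.Any using (here; there)
open import Data.List.Relation.Unary.Any.Properties using (any⁺; any⁻)
open import Data.List.Relation.Unary.Unique.Propositional using (Unique)
open import Data.List.Relation.Unary.Unique.Propositional.Properties
  using (filter⁺; upTo⁺; applyUpTo⁺₁; cartesianProduct⁺)
open import Data.Nat
  using (zero; _≤_; z≤n; s≤s; _^_; _/_; _≡ᵇ_; _≟_; NonZero; ≢-nonZero; ≢-nonZero⁻¹; nonTrivial⇒≢1; nonTrivial⇒n>1)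
open import Data.Nat.Coprimality as Coprime using (Coprime; coprime?; 1-coprimeTo; coprime-divisor; coprime-/gcd)
open import Data.Nat.DivMod using (m/n*n≡m; m*[n/m]≡n)
open import Data.Nat.Divisibility
  using (_∣_; _∣?_; divides; ∣-refl; ∣-trans; ∣-antisym; 0∣⇒≡0; 1∣_; ∣1⇒≡1; ∣⇒≤; m∣m*n; n∣m*n;
         *-cancelʳ-∣; *-monoʳ-∣; *-pres-∣)
open import Data.Nat.GCD using (gcd; gcd[m,n]∣m; gcd[m,n]∣n; gcd[m,n]≢0)
open import Data.Nat.ListAction using (sum)
open import Data.Nat.ListAction.Properties using (sum-↭)
open import Data.Nat.Primality using (Prime; prime; prime⇒irreducible; prime⇒nonZero; prime⇒nonTrivial)
open import Data.Nat.Properties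
  using (+-assoc; +-identityʳ; *-identityˡ; *-identityʳ; *-zeroʳ; *-comm; *-distribˡ-+; *-distribʳ-+;
         +-cancelʳ-≡; *-cancelˡ-≡; [m*n]*[o*p]≡[m*o]*[n*p]; suc-injective; ≡ᵇ⇒≡; ≡⇒≡ᵇ; m≤n⇒m≤1+n; <⇒≢;
         m*n≢0; m^n≢0; ^-monoʳ-<)
open import Data.Nat.Tactic.RingSolver using (solve-∀)
open import Algebra.Properties.CommutativeSemigroup Data.Nat.Properties.+-commutativeSemigroup
  using () renaming (interchange to +-interchange)
open import Data.Product using (_,_; ∃₂; ∃-syntax; uncurry)
import Data.Product as Product
open import Data.Sum using (inj₁; inj₂; [_,_]′)
open import Function using (_∘_)
open import Function.Bundles using (_⇔_; Equivalence; mk⇔)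
open import Level using (0ℓ)
open import Relation.Binary.PropositionalEquality
  using (_≢_; refl; sym; trans; cong; cong₂; subst; subst₂; ≢-sym; module ≡-Reasoning)
open import Relation.Nullary using (¬_; Dec; yes; no; ¬?; contradiction)
open import Relation.Nullary.Decidable using (does; _×-dec_; dec-true; dec-false; does-⇔)
open import Relation.Unary using (Pred; Decidable)

open ≡-Reasoning

private
  variable
    A B : Set

-- Sums over lists

𝟙 : Bool → ℕ
𝟙 true  = 1
𝟙 false = 0

∑ : List A → (A → ℕ) → ℕ
∑ xs f = sum (map f xs)

syntax ∑ xs (λ x → e) = ∑[ x ∈ xs ] e

∑-cong : ∀ (xs : List A) {f g : A → ℕ} → (∀ {x} → x ∈ xs → f x ≡ g x) → ∑ xs f ≡ ∑ xs g
∑-cong []       _   = refl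
∑-cong (x ∷ xs) f≡g = cong₂ _+_ (f≡g (here refl)) (∑-cong xs (f≡g ∘ there))

∑-zero : ∀ (xs : List A) {f : A → ℕ} → (∀ {x} → x ∈ xs → f x ≡ 0) → ∑ xs f ≡ 0
∑-zero []       _   = refl
∑-zero (x ∷ xs) f≡0 = cong₂ _+_ (f≡0 (here refl)) (∑-zero xs (f≡0 ∘ there))

∑-const : ∀ (xs : List A) (c : ℕ) → ∑[ _ ∈ xs ] c ≡ length xs * c
∑-const []       c = refl
∑-const (x ∷ xs) c = cong (c +_) (∑-const xs c)

∑-+ : ∀ (xs : List A) (f g : A → ℕ) → ∑[ x ∈ xs ] (f x + g x) ≡ ∑ xs f + ∑ xs g
∑-+ []       f g = refl
∑-+ (x ∷ xs) f g = begin
  f x + g x + ∑[ y ∈ xs ] (f y + g y) ≡⟨ cong (f x + g x +_) (∑-+ xs f g) ⟩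
  f x + g x + (∑ xs f + ∑ xs g)       ≡⟨ +-interchange (f x) (g x) (∑ xs f) (∑ xs g) ⟩
  f x + ∑ xs f + (g x + ∑ xs g)       ∎

∑-*ˡ : ∀ (c : ℕ) (xs : List A) (f : A → ℕ) → ∑[ x ∈ xs ] (c * f x) ≡ c * ∑ xs f
∑-*ˡ c []       f = sym (*-zeroʳ c)
∑-*ˡ c (x ∷ xs) f = trans (cong (c * f x +_) (∑-*ˡ c xs f)) (sym (*-distribˡ-+ c (f x) (∑ xs f)))

∑-++ : ∀ (xs ys : List A) (f : A → ℕ) → ∑ (xs ++ ys) f ≡ ∑ xs f + ∑ ys f
∑-++ []       ys f = refl
∑-++ (x ∷ xs) ys f = trans (cong (f x +_) (∑-++ xs ys f)) (sym (+-assoc (f x) (∑ xs f) (∑ ys f)))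

∑-↭ : ∀ {xs ys : List A} → xs ↭ ys → (f : A → ℕ) → ∑ xs f ≡ ∑ ys f
∑-↭ xs↭ys f = sum-↭ (map⁺ f xs↭ys)

∑-map : ∀ (g : A → B) (xs : List A) (f : B → ℕ) → ∑ (map g xs) f ≡ ∑ xs (f ∘ g)
∑-map g []       f = refl
∑-map g (x ∷ xs) f = cong (f (g x) +_) (∑-map g xs f)

∑-*-∑ : ∀ (xs : List A) (ys : List B) (f : A → ℕ) (g : B → ℕ) →
        ∑[ x ∈ xs ] ∑[ y ∈ ys ] (f x * g y) ≡ ∑ xs f * ∑ ys g
∑-*-∑ []       ys f g = refl
∑-*-∑ (x ∷ xs) ys f g = begin
  ∑[ y ∈ ys ] (f x * g y) + ∑[ x′ ∈ xs ] ∑[ y ∈ ys ] (f x′ * g y) ≡⟨ cong₂ _+_ (∑-*ˡ (f x) ys g) (∑-*-∑ xs ys f g) ⟩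
  f x * ∑ ys g + ∑ xs f * ∑ ys g                                  ≡⟨ *-distribʳ-+ (∑ ys g) (f x) (∑ xs f) ⟨
  (f x + ∑ xs f) * ∑ ys g                                         ∎

∑-cartesianProduct : ∀ (xs : List A) (ys : List B) (F : A → B → ℕ) →
                     ∑ (cartesianProduct xs ys) (uncurry F) ≡ ∑[ x ∈ xs ] ∑[ y ∈ ys ] F x y
∑-cartesianProduct []       ys F = refl
∑-cartesianProduct (x ∷ xs) ys F = begin
  ∑ (map (x ,_) ys ++ cartesianProduct xs ys) (uncurry F)
    ≡⟨ ∑-++ (map (x ,_) ys) (cartesianProduct xs ys) (uncurry F) ⟩
  ∑ (map (x ,_) ys) (uncurry F) + ∑ (cartesianProduct xs ys) (uncurry F)
    ≡⟨ cong₂ _+_ (∑-map (x ,_) ys (uncurry F)) (∑-cartesianProduct xs ys F) ⟩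
  ∑ ys (F x) + ∑[ x′ ∈ xs ] ∑ ys (F x′)
    ∎

∑-select : ∀ {xs : List ℕ} {x} → Unique xs → x ∈ xs → (h : ℕ → ℕ) → ∑[ y ∈ xs ] (𝟙 (x ≡ᵇ y) * h y) ≡ h x
∑-select {x ∷ xs} (x∉xs ∷ _) (here refl) h = begin
  𝟙 (x ≡ᵇ x) * h x + ∑[ y ∈ xs ] (𝟙 (x ≡ᵇ y) * h y)
    ≡⟨ cong₂ (λ b s → 𝟙 b * h x + s) (dec-true (x ≟ x) refl) (∑-zero xs x≢y) ⟩
  1 * h x + 0
    ≡⟨ trans (+-identityʳ (1 * h x)) (*-identityˡ (h x)) ⟩
  h x
    ∎
  where
  x≢y : ∀ {y} → y ∈ xs → 𝟙 (x ≡ᵇ y) * h y ≡ 0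
  x≢y {y} y∈xs = cong (λ b → 𝟙 b * h y) (dec-false (x ≟ y) (All.lookup x∉xs y∈xs))
∑-select {y ∷ xs} {x} (y∉xs ∷ !xs) (there x∈xs) h
  rewrite dec-false (x ≟ y) (λ x≡y → All.lookup y∉xs x∈xs (sym x≡y)) = ∑-select !xs x∈xs h

length-filter≡∑ : ∀ {P : Pred A 0ℓ} (P? : Decidable P) (xs : List A) →
                  length (filter P? xs) ≡ ∑[ x ∈ xs ] 𝟙 (does (P? x))
length-filter≡∑ P? []       = refl
length-filter≡∑ P? (x ∷ xs) with does (P? x)
... | true  = cong suc (length-filter≡∑ P? xs)
... | false = length-filter≡∑ P? xs

∈-pairs⁻ : ∀ {xs : List A} {x y} → (x , y) ∈ pairs xs → x ∈ xs × y ∈ xs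
∈-pairs⁻ {xs = z ∷ zs} xy∈ with ∈-++⁻ (map (z ,_) zs) xy∈
... | inj₁ xy∈map with ∈-map⁻ (z ,_) xy∈map
...   | _ , y∈zs , refl = here refl , there y∈zs
∈-pairs⁻ {xs = z ∷ zs} xy∈ | inj₂ xy∈pairs = Product.map there there (∈-pairs⁻ xy∈pairs)

∑-pairs : ∀ {A : Set} (xs : List A) (F : A → A → ℕ) →
          ∑ (pairs xs) (λ (x , y) → F x y + F y x) + ∑[ x ∈ xs ] F x x ≡ ∑[ x ∈ xs ] ∑ xs (F x)
∑-pairs     []       F = refl
∑-pairs {A} (x ∷ xs) F = begin
  ∑ (map (x ,_) xs ++ pairs xs) G + (F x x + D)
    ≡⟨ cong (_+ (F x x + D)) (∑-++ (map (x ,_) xs) (pairs xs) G) ⟩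
  ∑ (map (x ,_) xs) G + P + (F x x + D)
    ≡⟨ cong (λ t → t + P + (F x x + D)) (trans (∑-map (x ,_) xs G) (∑-+ xs (F x) (λ y → F y x))) ⟩
  R + C + P + (F x x + D)
    ≡⟨ regroup R C P (F x x) D ⟩
  F x x + R + (C + (P + D))
    ≡⟨ cong (λ t → F x x + R + (C + t)) (∑-pairs xs F) ⟩
  F x x + R + (C + ∑[ y ∈ xs ] ∑ xs (F y))
    ≡⟨ cong (F x x + R +_) (∑-+ xs (λ y → F y x) (λ y → ∑ xs (F y))) ⟨
  F x x + R + ∑[ y ∈ xs ] (F y x + ∑ xs (F y))
    ∎
  where
  G : A × A → ℕ
  G (y , z) = F y z + F z y
  R = ∑ xs (F x)
  C = ∑[ y ∈ xs ] F y x
  P = ∑ (pairs xs) G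
  D = ∑[ y ∈ xs ] F y y
  regroup : ∀ r c p f d → r + c + p + (f + d) ≡ f + r + (c + (p + d))
  regroup = solve-∀

∑-pairs-symmetric : ∀ {A : Set} (xs : List A) (g : A → ℕ) (d : A → A → ℕ) →
                    (∀ {x y} → x ∈ xs → y ∈ xs → d x y ≡ d y x) → (∀ x → d x x ≡ 0) →
                    ∑ (pairs xs) (λ (x , y) → (g x + g y) * d x y) ≡ ∑[ x ∈ xs ] (g x * ∑ xs (d x))
∑-pairs-symmetric {A} xs g d d-sym d-diag = begin
  ∑ (pairs xs) (λ (x , y) → (g x + g y) * d x y) ≡⟨ ∑-cong (pairs xs) split ⟩
  S                                              ≡⟨ +-identityʳ S ⟨
  S + 0                                          ≡⟨ cong (S +_) diagonal ⟨
  S + ∑[ x ∈ xs ] F x x                          ≡⟨ ∑-pairs xs F ⟩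
  ∑[ x ∈ xs ] ∑ xs (F x)                         ≡⟨ ∑-cong xs (λ {x} _ → ∑-*ˡ (g x) xs (d x)) ⟩
  ∑[ x ∈ xs ] (g x * ∑ xs (d x))                 ∎
  where
  F : A → A → ℕ
  F x y = g x * d x y
  S = ∑ (pairs xs) (λ (x , y) → F x y + F y x)
  split : ∀ {p} → p ∈ pairs xs →
          (g (proj₁ p) + g (proj₂ p)) * d (proj₁ p) (proj₂ p) ≡ F (proj₁ p) (proj₂ p) + F (proj₂ p) (proj₁ p)
  split {x , y} xy∈ = trans (*-distribʳ-+ (d x y) (g x) (g y)) (cong (λ t → F x y + g y * t) (uncurry d-sym (∈-pairs⁻ xy∈)))
  diagonal : ∑[ x ∈ xs ] F x x ≡ 0
  diagonal = ∑-zero xs (λ {x} _ → trans (cong (g x *_) (d-diag x)) (*-zeroʳ (g x)))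

-- Distances and degrees in the divisor prime graph

Adjacent : ℕ → ℕ → Set
Adjacent u v = u ≢ v × Coprime u v

-- adj u v is definitionally does (adjacent? u v): does (u ≟ v) is u ≡ᵇ v and
-- does (coprime? u v) is gcd u v ≡ᵇ 1.
adjacent? : ∀ u v → Dec (Adjacent u v)
adjacent? u v = ¬? (u ≟ v) ×-dec coprime? u v

≡ᵇ-refl : ∀ n → (n ≡ᵇ n) ≡ true
≡ᵇ-refl n = dec-true (n ≟ n) refl

≢⇒≡ᵇ-false : ∀ {m n} → m ≢ n → (m ≡ᵇ n) ≡ false
≢⇒≡ᵇ-false {m} {n} = dec-false (m ≟ n)

adj-sym : ∀ u v → adj u v ≡ adj v u
adj-sym u v = does-⇔ (mk⇔ swap swap) (adjacent? u v) (adjacent? v u)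
  where
  swap : ∀ {x y} → Adjacent x y → Adjacent y x
  swap (x≢y , x⊥y) = ≢-sym x≢y , Coprime.sym x⊥y

adj-irrefl : ∀ u → adj u u ≡ false
adj-irrefl u = dec-false (adjacent? u u) (λ (u≢u , _) → u≢u refl)

adj-1ˡ : ∀ {v} → v ≢ 1 → adj 1 v ≡ true
adj-1ˡ {v} v≢1 = dec-true (adjacent? 1 v) (≢-sym v≢1 , 1-coprimeTo v)

adj-1ʳ : ∀ {u} → u ≢ 1 → adj u 1 ≡ true
adj-1ʳ {u} u≢1 = trans (adj-sym u 1) (adj-1ˡ u≢1)

reach-1⁺ : ∀ {V u v} → u ∈ V → T (adj u v) → T (reach V 1 u v)
reach-1⁺ {V} {u} {v} u∈V uv =
  Equivalence.from T-∨ (inj₂ (any⁺ _ (lose u∈V (Equivalence.from T-∧ (≡⇒≡ᵇ u u refl , uv)))))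

reach-1⁻ : ∀ {V u v} → u ≢ v → T (reach V 1 u v) → T (adj u v)
reach-1⁻ {V} {u} {v} u≢v r with Equivalence.to (T-∨ {u ≡ᵇ v}) r
... | inj₁ u≡ᵇv = contradiction (≡ᵇ⇒≡ u v u≡ᵇv) u≢v
... | inj₂ r′ with find (any⁻ _ V r′)
...   | w , _ , uw∧wv with Equivalence.to (T-∧ {u ≡ᵇ w}) uw∧wv
...     | u≡ᵇw , wv = subst (λ z → T (adj z v)) (sym (≡ᵇ⇒≡ u w u≡ᵇw)) wv

reach-2-via : ∀ {V u v w} → w ∈ V → u ∈ V → T (adj u w) → T (adj w v) → T (reach V 2 u v)
reach-2-via w∈V u∈V uw wv =
  Equivalence.from T-∨ (inj₂ (any⁺ _ (lose w∈V (Equivalence.from T-∧ (reach-1⁺ u∈V uw , wv)))))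

firstReach-hit : ∀ V i b {u v} → T (reach V i u v) → firstReach V i b u v ≡ i
firstReach-hit V i zero    {u} {v} r with reach V i u v
... | true = refl
firstReach-hit V i (suc b) {u} {v} r with reach V i u v
... | true = refl

firstReach-miss : ∀ V i b {u v} → reach V i u v ≡ false → firstReach V i (suc b) u v ≡ firstReach V (suc i) b u v
firstReach-miss V i b r rewrite r = refl

firstReach-≢ : ∀ {V u v} b → 1 ∈ V → u ∈ V → u ≢ v → firstReach V 0 (2 + b) u v + 𝟙 (adj u v) ≡ 2
firstReach-≢ {V} {u} {v} b 1∈V u∈V u≢v =
  trans (cong (_+ 𝟙 (adj u v)) (firstReach-miss V 0 (suc b) (≢⇒≡ᵇ-false u≢v))) from-1
  where
  from-1 : firstReach V 1 (suc b) u v + 𝟙 (adj u v) ≡ 2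
  from-1 with adj u v in uv
  ... | true  = cong (_+ 1) (firstReach-hit V 1 (suc b) (reach-1⁺ u∈V (Equivalence.from T-≡ uv)))
  ... | false = cong (_+ 0) (trans (firstReach-miss V 1 b ¬reach₁) (firstReach-hit V 2 b reach₂))
    where
    ¬reach₁ : reach V 1 u v ≡ false
    ¬reach₁ = ¬-not (λ r → subst T uv (reach-1⁻ {V} u≢v (Equivalence.from T-≡ r)))
    u≢1 : u ≢ 1
    u≢1 refl = contradiction (trans (sym uv) (adj-1ˡ (≢-sym u≢v))) λ ()
    v≢1 : v ≢ 1
    v≢1 refl = contradiction (trans (sym uv) (adj-1ʳ u≢v)) λ ()
    reach₂ : T (reach V 2 u v)
    reach₂ = reach-2-via 1∈V u∈V (Equivalence.from T-≡ (adj-1ʳ u≢1)) (Equivalence.from T-≡ (adj-1ˡ v≢1))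

distance : List ℕ → ℕ → ℕ → ℕ
distance V = firstReach V 0 (length V)

distance-self : ∀ V u → distance V u u ≡ 0
distance-self V u = firstReach-hit V 0 (length V) (≡⇒≡ᵇ u u refl)

length≥2 : ∀ {V : List ℕ} {u v} → u ∈ V → v ∈ V → u ≢ v → ∃[ b ] length V ≡ 2 + b
length≥2 {_ ∷ _ ∷ V} _           _           _   = length V , refl
length≥2 {_ ∷ []}    (here refl) (here refl) u≢v = contradiction refl u≢v

distance-≢ : ∀ {V u v} → 1 ∈ V → u ∈ V → v ∈ V → u ≢ v → distance V u v + 𝟙 (adj u v) ≡ 2
distance-≢ {V} {u} {v} 1∈V u∈V v∈V u≢v with b , |V|≡2+b ← length≥2 u∈V v∈V u≢v =
  subst (λ L → firstReach V 0 L u v + 𝟙 (adj u v) ≡ 2) (sym |V|≡2+b) (firstReach-≢ b 1∈V u∈V u≢v)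

distance-sym : ∀ {V u v} → 1 ∈ V → u ∈ V → v ∈ V → distance V u v ≡ distance V v u
distance-sym {V} {u} {v} 1∈V u∈V v∈V with u ≟ v
... | yes refl = refl
... | no u≢v   = +-cancelʳ-≡ (𝟙 (adj u v)) (distance V u v) (distance V v u) (begin
  distance V u v + 𝟙 (adj u v) ≡⟨ distance-≢ 1∈V u∈V v∈V u≢v ⟩
  2                            ≡⟨ distance-≢ 1∈V v∈V u∈V (≢-sym u≢v) ⟨
  distance V v u + 𝟙 (adj v u) ≡⟨ cong (λ b → distance V v u + 𝟙 b) (adj-sym v u) ⟩
  distance V v u + 𝟙 (adj u v) ∎)

transmission : List ℕ → ℕ → ℕ
transmission V u = ∑ V (distance V u)

degree : List ℕ → ℕ → ℕ
degree V u = ∑[ v ∈ V ] 𝟙 (adj u v)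

deg≡degree : ∀ n u → deg n u ≡ degree (divisors n) u
deg≡degree n u = length-filter≡∑ (λ v → T? (adj u v)) (divisors n)

schultz≡∑degree*transmission : ∀ n → 1 ∈ divisors n →
  schultz n ≡ ∑[ u ∈ divisors n ] (degree (divisors n) u * transmission (divisors n) u)
schultz≡∑degree*transmission n 1∈V = begin
  schultz n
    ≡⟨ ∑-cong (pairs V) (λ {(x , y)} _ → cong (_* distance V x y) (cong₂ _+_ (deg≡degree n x) (deg≡degree n y))) ⟩
  ∑ (pairs V) (λ (x , y) → (degree V x + degree V y) * distance V x y)
    ≡⟨ ∑-pairs-symmetric V (degree V) (distance V) (distance-sym 1∈V) (distance-self V) ⟩
  ∑[ u ∈ V ] (degree V u * transmission V u)
    ∎
  where
  V = divisors n

transmission+degree : ∀ {V u} → Unique V → 1 ∈ V → u ∈ V → transmission V u + degree V u + 2 ≡ 2 * length V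
transmission+degree {V} {u} !V 1∈V u∈V = begin
  transmission V u + degree V u + 2
    ≡⟨ cong (transmission V u + degree V u +_) (∑-select !V u∈V (λ _ → 2)) ⟨
  transmission V u + degree V u + ∑[ v ∈ V ] (𝟙 (u ≡ᵇ v) * 2)
    ≡⟨ cong (_+ ∑[ v ∈ V ] (𝟙 (u ≡ᵇ v) * 2)) (∑-+ V (distance V u) (λ v → 𝟙 (adj u v))) ⟨
  ∑[ v ∈ V ] (distance V u v + 𝟙 (adj u v)) + ∑[ v ∈ V ] (𝟙 (u ≡ᵇ v) * 2)
    ≡⟨ ∑-+ V (λ v → distance V u v + 𝟙 (adj u v)) (λ v → 𝟙 (u ≡ᵇ v) * 2) ⟨
  ∑[ v ∈ V ] (distance V u v + 𝟙 (adj u v) + 𝟙 (u ≡ᵇ v) * 2)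
    ≡⟨ ∑-cong V (λ {v} → term (u ≟ v)) ⟩
  ∑[ _ ∈ V ] 2
    ≡⟨ trans (∑-const V 2) (*-comm (length V) 2) ⟩
  2 * length V
    ∎
  where
  -- A Dec argument rather than 'with u ≟ v': the latter also abstracts the u ≟ v hidden
  -- in the unfolded gcd u v, which makes the branches ill-typed.
  term : ∀ {v} → Dec (u ≡ v) → v ∈ V → distance V u v + 𝟙 (adj u v) + 𝟙 (u ≡ᵇ v) * 2 ≡ 2
  term (yes refl) _ =
    trans (cong₂ (λ d a → d + 𝟙 a + 𝟙 (u ≡ᵇ u) * 2) (distance-self V u) (adj-irrefl u))
          (cong (λ b → 𝟙 b * 2) (≡ᵇ-refl u))
  term {v} (no u≢v) v∈V =
    trans (cong (λ b → distance V u v + 𝟙 (adj u v) + 𝟙 b * 2) (≢⇒≡ᵇ-false u≢v))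
          (trans (+-identityʳ _) (distance-≢ 1∈V u∈V v∈V u≢v))

∑degree*transmission+∑degree² : ∀ {V} → Unique V → 1 ∈ V →
  ∑[ u ∈ V ] (degree V u * transmission V u) + ∑[ u ∈ V ] (degree V u * degree V u) + 2 * ∑ V (degree V)
    ≡ 2 * length V * ∑ V (degree V)
∑degree*transmission+∑degree² {V} !V 1∈V = begin
  ∑[ u ∈ V ] (g u * t u) + ∑[ u ∈ V ] (g u * g u) + 2 * ∑ V g
    ≡⟨ cong (∑[ u ∈ V ] (g u * t u) + ∑[ u ∈ V ] (g u * g u) +_) (∑-*ˡ 2 V g) ⟨
  ∑[ u ∈ V ] (g u * t u) + ∑[ u ∈ V ] (g u * g u) + ∑[ u ∈ V ] (2 * g u)
    ≡⟨ cong (_+ ∑[ u ∈ V ] (2 * g u)) (∑-+ V (λ u → g u * t u) (λ u → g u * g u)) ⟨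
  ∑[ u ∈ V ] (g u * t u + g u * g u) + ∑[ u ∈ V ] (2 * g u)
    ≡⟨ ∑-+ V (λ u → g u * t u + g u * g u) (λ u → 2 * g u) ⟨
  ∑[ u ∈ V ] (g u * t u + g u * g u + 2 * g u)
    ≡⟨ ∑-cong V term ⟩
  ∑[ u ∈ V ] (2 * length V * g u)
    ≡⟨ ∑-*ˡ (2 * length V) V g ⟩
  2 * length V * ∑ V g
    ∎
  where
  g = degree V
  t = transmission V
  factor : ∀ x y z → x * y + x * z + 2 * x ≡ (y + z + 2) * x
  factor = solve-∀
  term : ∀ {u} → u ∈ V → g u * t u + g u * g u + 2 * g u ≡ 2 * length V * g u
  term {u} u∈V = trans (factor (g u) (t u) (g u)) (cong (_* g u) (transmission+degree !V 1∈V u∈V))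

coprimeCount : List ℕ → ℕ → ℕ
coprimeCount V u = ∑[ v ∈ V ] 𝟙 (does (coprime? u v))

coprimeCount-1 : ∀ V → coprimeCount V 1 ≡ length V
coprimeCount-1 V = begin
  ∑[ v ∈ V ] 𝟙 (does (coprime? 1 v)) ≡⟨ ∑-cong V (λ {v} _ → cong 𝟙 (dec-true (coprime? 1 v) (1-coprimeTo v))) ⟩
  ∑[ _ ∈ V ] 1                        ≡⟨ ∑-const V 1 ⟩
  length V * 1                        ≡⟨ *-identityʳ (length V) ⟩
  length V                            ∎

degree+𝟙≡coprimeCount : ∀ {V u} → Unique V → u ∈ V → degree V u + 𝟙 (1 ≡ᵇ u) ≡ coprimeCount V u
degree+𝟙≡coprimeCount {V} {u} !V u∈V = begin
  degree V u + 𝟙 (1 ≡ᵇ u)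
    ≡⟨ cong (λ b → degree V u + 𝟙 b) (does-⇔ 1≡⇔coprime (1 ≟ u) (coprime? u u)) ⟩
  degree V u + 𝟙 (does (coprime? u u))
    ≡⟨ cong (degree V u +_) (∑-select !V u∈V (λ v → 𝟙 (does (coprime? u v)))) ⟨
  degree V u + ∑[ v ∈ V ] (𝟙 (u ≡ᵇ v) * 𝟙 (does (coprime? u v)))
    ≡⟨ ∑-+ V (λ v → 𝟙 (adj u v)) (λ v → 𝟙 (u ≡ᵇ v) * 𝟙 (does (coprime? u v))) ⟨
  ∑[ v ∈ V ] (𝟙 (adj u v) + 𝟙 (u ≡ᵇ v) * 𝟙 (does (coprime? u v)))
    ≡⟨ ∑-cong V (λ {v} _ → 𝟙-split (u ≡ᵇ v) (does (coprime? u v))) ⟩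
  coprimeCount V u
    ∎
  where
  1≡⇔coprime : 1 ≡ u ⇔ Coprime u u
  1≡⇔coprime = mk⇔ (λ { refl → 1-coprimeTo 1 }) (λ u⊥u → sym (u⊥u (∣-refl , ∣-refl)))
  𝟙-split : ∀ b c → 𝟙 (not b ∧ c) + 𝟙 b * 𝟙 c ≡ 𝟙 c
  𝟙-split false c     = +-identityʳ (𝟙 c)
  𝟙-split true  false = refl
  𝟙-split true  true  = refl

∑degree+1≡∑coprimeCount : ∀ {V} → Unique V → 1 ∈ V → ∑ V (degree V) + 1 ≡ ∑ V (coprimeCount V)
∑degree+1≡∑coprimeCount {V} !V 1∈V = begin
  ∑ V (degree V) + 1
    ≡⟨ cong (∑ V (degree V) +_) (∑-select !V 1∈V (λ _ → 1)) ⟨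
  ∑ V (degree V) + ∑[ u ∈ V ] (𝟙 (1 ≡ᵇ u) * 1)
    ≡⟨ ∑-+ V (degree V) (λ u → 𝟙 (1 ≡ᵇ u) * 1) ⟨
  ∑[ u ∈ V ] (degree V u + 𝟙 (1 ≡ᵇ u) * 1)
    ≡⟨ ∑-cong V (λ {u} u∈V → trans (cong (degree V u +_) (*-identityʳ _)) (degree+𝟙≡coprimeCount !V u∈V)) ⟩
  ∑ V (coprimeCount V)
    ∎

∑degree²+2|V|≡∑coprimeCount²+1 : ∀ {V} → Unique V → 1 ∈ V →
  ∑[ u ∈ V ] (degree V u * degree V u) + 2 * length V ≡ ∑[ u ∈ V ] (coprimeCount V u * coprimeCount V u) + 1
∑degree²+2|V|≡∑coprimeCount²+1 {V} !V 1∈V = begin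
  Q + 2 * length V                                     ≡⟨ cong (λ t → Q + 2 * t) |V|≡g[1]+1 ⟩
  Q + 2 * (g 1 + 1)                                    ≡⟨ regroup Q (g 1) ⟩
  Q + (2 * g 1 + 1) + 1                                ≡⟨ cong (λ t → Q + t + 1) (∑-select !V 1∈V (λ u → 2 * g u + e u)) ⟨
  Q + ∑[ u ∈ V ] (e u * (2 * g u + e u)) + 1           ≡⟨ cong (_+ 1) (∑-+ V (λ u → g u * g u) (λ u → e u * (2 * g u + e u))) ⟨
  ∑[ u ∈ V ] (g u * g u + e u * (2 * g u + e u)) + 1   ≡⟨ cong (_+ 1) (∑-cong V square) ⟩
  ∑[ u ∈ V ] (coprimeCount V u * coprimeCount V u) + 1 ∎
  where
  g = degree V
  e = λ u → 𝟙 (1 ≡ᵇ u)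
  Q = ∑[ u ∈ V ] (g u * g u)
  |V|≡g[1]+1 : length V ≡ g 1 + 1
  |V|≡g[1]+1 = sym (trans (degree+𝟙≡coprimeCount !V 1∈V) (coprimeCount-1 V))
  regroup : ∀ q x → q + 2 * (x + 1) ≡ q + (2 * x + 1) + 1
  regroup = solve-∀
  expand : ∀ x y → x * x + y * (2 * x + y) ≡ (x + y) * (x + y)
  expand = solve-∀
  square : ∀ {u} → u ∈ V → g u * g u + e u * (2 * g u + e u) ≡ coprimeCount V u * coprimeCount V u
  square {u} u∈V = trans (expand (g u) (e u)) (cong (λ t → t * t) (degree+𝟙≡coprimeCount !V u∈V))

-- Divisors of coprime products

Unique-map⁺-local : ∀ {f : A → B} {xs} → (∀ {x y} → x ∈ xs → y ∈ xs → f x ≡ f y → x ≡ y) →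
                    Unique xs → Unique (map f xs)
Unique-map⁺-local f-inj []           = []
Unique-map⁺-local f-inj (x∉xs ∷ !xs) =
  All-map⁺ (All.tabulate (λ y∈xs fx≡fy → All.lookup x∉xs y∈xs (f-inj (here refl) (there y∈xs) fx≡fy)))
  ∷ Unique-map⁺-local (λ x∈ y∈ → f-inj (there x∈) (there y∈)) !xs

∈-divisors⁻ : ∀ {n d} → d ∈ divisors n → d ∣ n
∈-divisors⁻ {n} d∈ = proj₂ (∈-filter⁻ (_∣? n) {xs = map suc (upTo n)} d∈)

∈-divisors⁺ : ∀ {n d} .{{_ : NonZero n}} → d ∣ n → d ∈ divisors n
∈-divisors⁺ {n} {zero}  0∣n = contradiction (0∣⇒≡0 0∣n) (≢-nonZero⁻¹ n)
∈-divisors⁺ {n} {suc d} d∣n = ∈-filter⁺ (_∣? n) (∈-map⁺ suc (∈-upTo⁺ (∣⇒≤ d∣n))) d∣n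

divisors-unique : ∀ n → Unique (divisors n)
divisors-unique n = filter⁺ (_∣? n) (Unique-map⁺-local (λ _ _ → suc-injective) (upTo⁺ n))

coprime-∣ : ∀ {a b x y} → Coprime a b → x ∣ a → y ∣ b → Coprime x y
coprime-∣ a⊥b x∣a y∣b (i∣x , i∣y) = a⊥b (∣-trans i∣x x∣a , ∣-trans i∣y y∣b)

coprime-*ʳ : ∀ {m n k} → Coprime m n → Coprime m k → Coprime m (n * k)
coprime-*ʳ m⊥n m⊥k (i∣m , i∣nk) = m⊥k (i∣m , coprime-divisor (coprime-∣ m⊥n i∣m ∣-refl) i∣nk)

coprime-*-*⇔ : ∀ {x y v w} → Coprime x w → Coprime y v → Coprime (x * y) (v * w) ⇔ (Coprime x v × Coprime y w)
coprime-*-*⇔ {x} {y} {v} {w} x⊥w y⊥v = mk⇔ split join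
  where
  split : Coprime (x * y) (v * w) → Coprime x v × Coprime y w
  split xy⊥vw = coprime-∣ xy⊥vw (m∣m*n y) (m∣m*n w) , coprime-∣ xy⊥vw (n∣m*n x) (n∣m*n v)
  join : Coprime x v × Coprime y w → Coprime (x * y) (v * w)
  join (x⊥v , y⊥w) = Coprime.sym (coprime-*ʳ (Coprime.sym (coprime-*ʳ x⊥v x⊥w)) (Coprime.sym (coprime-*ʳ y⊥v y⊥w)))

-- d = gcd(d, a) · (d / gcd(d, a)), and the second factor is coprime to a / gcd(d, a), hence divides b.
∣*-coprime-split : ∀ {a b d} .{{_ : NonZero a}} → Coprime a b → d ∣ a * b → ∃₂ λ x y → x ∣ a × y ∣ b × d ≡ x * y
∣*-coprime-split {a} {b} {d} a⊥b d∣ab = g , d / g , gcd[m,n]∣n d a , d/g∣b , sym (m*[n/m]≡n (gcd[m,n]∣m d a))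
  where
  g = gcd d a
  instance
    g≢0 : NonZero g
    g≢0 = ≢-nonZero (gcd[m,n]≢0 d a (inj₂ (≢-nonZero⁻¹ a)))
  swap-last : ∀ x y z → x * y * z ≡ x * z * y
  swap-last = solve-∀
  d/g*g∣a/g*b*g : d / g * g ∣ a / g * b * g
  d/g*g∣a/g*b*g = subst₂ _∣_ (sym (m/n*n≡m (gcd[m,n]∣m d a)))
                             (trans (cong (_* b) (sym (m/n*n≡m (gcd[m,n]∣n d a)))) (swap-last (a / g) g b)) d∣ab
  d/g∣b : d / g ∣ b
  d/g∣b = coprime-divisor (coprime-/gcd d a) (*-cancelʳ-∣ g d/g*g∣a/g*b*g)

coprime-divisors-*-injective : ∀ {a b x x′ y y′} .{{_ : NonZero a}} → Coprime a b →
                               x ∣ a → x′ ∣ a → y ∣ b → y′ ∣ b → x * y ≡ x′ * y′ → x ≡ x′ × y ≡ y′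
coprime-divisors-*-injective {a} {b} {x} {x′} {y} {y′} a⊥b x∣a x′∣a y∣b y′∣b xy≡x′y′ = x≡x′ , y≡y′
  where
  x≡x′ : x ≡ x′
  x≡x′ = ∣-antisym
    (coprime-divisor (coprime-∣ a⊥b x∣a y′∣b) (subst (x ∣_) (trans xy≡x′y′ (*-comm x′ y′)) (m∣m*n y)))
    (coprime-divisor (coprime-∣ a⊥b x′∣a y∣b) (subst (x′ ∣_) (trans (sym xy≡x′y′) (*-comm x y)) (m∣m*n y′)))
  instance
    x≢0 : NonZero x
    x≢0 = ≢-nonZero (λ { refl → ≢-nonZero⁻¹ a (0∣⇒≡0 x∣a) })
  y≡y′ : y ≡ y′
  y≡y′ = *-cancelˡ-≡ y y′ x (trans xy≡x′y′ (cong (_* y′) (sym x≡x′)))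

divisors-*-↭ : ∀ {a b} .{{_ : NonZero a}} .{{_ : NonZero b}} → Coprime a b →
               divisors (a * b) ↭ map (uncurry _*_) (cartesianProduct (divisors a) (divisors b))
divisors-*-↭ {a} {b} a⊥b = ∼bag⇒↭ (unique∧set⇒bag (divisors-unique (a * b)) !products (mk⇔ to from))
  where
  instance
    ab≢0 : NonZero (a * b)
    ab≢0 = m*n≢0 a b
  products = cartesianProduct (divisors a) (divisors b)
  injective : ∀ {p q} → p ∈ products → q ∈ products → uncurry _*_ p ≡ uncurry _*_ q → p ≡ q
  injective p∈ q∈ xy≡x′y′
    with x∈ , y∈ ← ∈-cartesianProduct⁻ (divisors a) (divisors b) p∈
       | x′∈ , y′∈ ← ∈-cartesianProduct⁻ (divisors a) (divisors b) q∈
    with refl , refl ← coprime-divisors-*-injective a⊥b (∈-divisors⁻ x∈) (∈-divisors⁻ x′∈)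
                                                        (∈-divisors⁻ y∈) (∈-divisors⁻ y′∈) xy≡x′y′
    = refl
  !products : Unique (map (uncurry _*_) products)
  !products = Unique-map⁺-local injective (cartesianProduct⁺ (divisors-unique a) (divisors-unique b))
  to : ∀ {d} → d ∈ divisors (a * b) → d ∈ map (uncurry _*_) products
  to d∈ with x , y , x∣a , y∣b , refl ← ∣*-coprime-split a⊥b (∈-divisors⁻ d∈) =
    ∈-map⁺ (uncurry _*_) (∈-cartesianProduct⁺ (∈-divisors⁺ x∣a) (∈-divisors⁺ y∣b))
  from : ∀ {d} → d ∈ map (uncurry _*_) products → d ∈ divisors (a * b)
  from d∈ with _ , xy∈ , refl ← ∈-map⁻ (uncurry _*_) d∈
          with x∈ , y∈ ← ∈-cartesianProduct⁻ (divisors a) (divisors b) xy∈ =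
    ∈-divisors⁺ (*-pres-∣ (∈-divisors⁻ {a} x∈) (∈-divisors⁻ {b} y∈))

∑-divisors-* : ∀ {a b} .{{_ : NonZero a}} .{{_ : NonZero b}} → Coprime a b → (f : ℕ → ℕ) →
               ∑ (divisors (a * b)) f ≡ ∑[ x ∈ divisors a ] ∑[ y ∈ divisors b ] f (x * y)
∑-divisors-* {a} {b} a⊥b f = begin
  ∑ (divisors (a * b)) f                                        ≡⟨ ∑-↭ (divisors-*-↭ a⊥b) f ⟩
  ∑ (map (uncurry _*_) products) f                              ≡⟨ ∑-map (uncurry _*_) products f ⟩
  ∑ products (f ∘ uncurry _*_)                                  ≡⟨ ∑-cartesianProduct (divisors a) (divisors b) (λ x y → f (x * y)) ⟩
  ∑[ x ∈ divisors a ] ∑[ y ∈ divisors b ] f (x * y)             ∎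
  where
  products = cartesianProduct (divisors a) (divisors b)

-- Multiplicative functions

record Multiplicative (f : ℕ → ℕ) : Set where
  field
    1-homo : f 1 ≡ 1
    *-homo : ∀ {m n} .{{_ : NonZero m}} .{{_ : NonZero n}} → Coprime m n → f (m * n) ≡ f m * f n

DivisorMultiplicative : (ℕ → ℕ → ℕ) → Set
DivisorMultiplicative F =
  ∀ {a b x y} .{{_ : NonZero a}} .{{_ : NonZero b}} → Coprime a b → x ∣ a → y ∣ b → F (a * b) (x * y) ≡ F a x * F b y

divisorSum : (ℕ → ℕ → ℕ) → ℕ → ℕ
divisorSum F n = ∑ (divisors n) (F n)

divisorSum-multiplicative : ∀ {F} → F 1 1 ≡ 1 → DivisorMultiplicative F → Multiplicative (divisorSum F)
divisorSum-multiplicative {F} F[1,1]≡1 F-mult = record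
  { 1-homo = trans (+-identityʳ (F 1 1)) F[1,1]≡1
  ; *-homo = *-homo
  }
  where
  *-homo : ∀ {a b} .{{_ : NonZero a}} .{{_ : NonZero b}} → Coprime a b →
           divisorSum F (a * b) ≡ divisorSum F a * divisorSum F b
  *-homo {a} {b} a⊥b = begin
    ∑ (divisors (a * b)) (F (a * b))
      ≡⟨ ∑-divisors-* a⊥b (F (a * b)) ⟩
    ∑[ x ∈ divisors a ] ∑[ y ∈ divisors b ] F (a * b) (x * y)
      ≡⟨ ∑-cong (divisors a) (λ x∈ → ∑-cong (divisors b) (λ y∈ → F-mult a⊥b (∈-divisors⁻ x∈) (∈-divisors⁻ y∈))) ⟩
    ∑[ x ∈ divisors a ] ∑[ y ∈ divisors b ] (F a x * F b y)
      ≡⟨ ∑-*-∑ (divisors a) (divisors b) (F a) (F b) ⟩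
    ∑ (divisors a) (F a) * ∑ (divisors b) (F b)
      ∎

coprimeCount-multiplicative : DivisorMultiplicative (coprimeCount ∘ divisors)
coprimeCount-multiplicative {a} {b} {x} {y} a⊥b x∣a y∣b = begin
  ∑[ v ∈ divisors (a * b) ] 𝟙 (does (coprime? (x * y) v))
    ≡⟨ ∑-divisors-* a⊥b (λ v → 𝟙 (does (coprime? (x * y) v))) ⟩
  ∑[ v ∈ divisors a ] ∑[ w ∈ divisors b ] 𝟙 (does (coprime? (x * y) (v * w)))
    ≡⟨ ∑-cong (divisors a) (λ v∈ → ∑-cong (divisors b) (λ w∈ → 𝟙-coprime (∈-divisors⁻ v∈) (∈-divisors⁻ w∈))) ⟩
  ∑[ v ∈ divisors a ] ∑[ w ∈ divisors b ] (𝟙 (does (coprime? x v)) * 𝟙 (does (coprime? y w)))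
    ≡⟨ ∑-*-∑ (divisors a) (divisors b) (λ v → 𝟙 (does (coprime? x v))) (λ w → 𝟙 (does (coprime? y w))) ⟩
  coprimeCount (divisors a) x * coprimeCount (divisors b) y
    ∎
  where
  𝟙-∧ : ∀ b c → 𝟙 (b ∧ c) ≡ 𝟙 b * 𝟙 c
  𝟙-∧ true  c = sym (+-identityʳ (𝟙 c))
  𝟙-∧ false c = refl
  𝟙-coprime : ∀ {v w} → v ∣ a → w ∣ b →
              𝟙 (does (coprime? (x * y) (v * w))) ≡ 𝟙 (does (coprime? x v)) * 𝟙 (does (coprime? y w))
  𝟙-coprime {v} {w} v∣a w∣b = trans
    (cong 𝟙 (does-⇔ (coprime-*-*⇔ (coprime-∣ a⊥b x∣a w∣b) (coprime-∣ (Coprime.sym a⊥b) y∣b v∣a))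
                    (coprime? (x * y) (v * w)) (coprime? x v ×-dec coprime? y w)))
    (𝟙-∧ (does (coprime? x v)) (does (coprime? y w)))

divisorCount : ℕ → ℕ
divisorCount = divisorSum (λ _ _ → 1)

coprimePairCount : ℕ → ℕ
coprimePairCount = divisorSum (coprimeCount ∘ divisors)

coprimeTripleCount : ℕ → ℕ
coprimeTripleCount = divisorSum (λ n u → coprimeCount (divisors n) u * coprimeCount (divisors n) u)

length-divisors : ∀ n → length (divisors n) ≡ divisorCount n
length-divisors n = sym (trans (∑-const (divisors n) 1) (*-identityʳ _))

divisorCount-multiplicative : Multiplicative divisorCount
divisorCount-multiplicative = divisorSum-multiplicative refl (λ _ _ _ → refl)

coprimePairCount-multiplicative : Multiplicative coprimePairCount
coprimePairCount-multiplicative = divisorSum-multiplicative refl coprimeCount-multiplicative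

coprimeTripleCount-multiplicative : Multiplicative coprimeTripleCount
coprimeTripleCount-multiplicative = divisorSum-multiplicative refl λ {a} {b} {x} {y} a⊥b x∣a y∣b →
  trans (cong (λ t → t * t) (coprimeCount-multiplicative a⊥b x∣a y∣b))
        ([m*n]*[o*p]≡[m*o]*[n*p] (coprimeCount (divisors a) x) (coprimeCount (divisors b) y) _ _)

primePowerProduct : List (ℕ × ℕ) → ℕ
primePowerProduct fs = product (map (λ pk → proj₁ pk ^ proj₂ pk) fs)

primePowerProduct-nonZero : ∀ {fs} → All (Prime ∘ proj₁) fs → NonZero (primePowerProduct fs)
primePowerProduct-nonZero []                                = _
primePowerProduct-nonZero {(p , k) ∷ fs} (p-prime ∷ primes) =
  m*n≢0 (p ^ k) (primePowerProduct fs) {{m^n≢0 p k {{prime⇒nonZero p-prime}}}} {{primePowerProduct-nonZero primes}}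

prime∤⇒coprime : ∀ {p n} → Prime p → ¬ p ∣ n → Coprime p n
prime∤⇒coprime p-prime p∤n (i∣p , i∣n) with prime⇒irreducible p-prime i∣p
... | inj₁ i≡1  = i≡1
... | inj₂ refl = contradiction i∣n p∤n

distinct-primes-coprime : ∀ {p q} → Prime p → Prime q → p ≢ q → Coprime p q
distinct-primes-coprime p-prime@(prime _) q-prime p≢q =
  prime∤⇒coprime p-prime (λ p∣q → [ nonTrivial⇒≢1 , p≢q ]′ (prime⇒irreducible q-prime p∣q))

coprime-^ʳ : ∀ {m n} k → Coprime m n → Coprime m (n ^ k)
coprime-^ʳ {m} zero    _   = Coprime.sym (1-coprimeTo m)
coprime-^ʳ     (suc k) m⊥n = coprime-*ʳ m⊥n (coprime-^ʳ k m⊥n)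

prime-coprime-primePowerProduct : ∀ {p fs} → Prime p → All (Prime ∘ proj₁) fs → All ((p ≢_) ∘ proj₁) fs →
                                  Coprime p (primePowerProduct fs)
prime-coprime-primePowerProduct {p} _ [] [] = Coprime.sym (1-coprimeTo p)
prime-coprime-primePowerProduct {fs = (q , k) ∷ _} p-prime (q-prime ∷ primes) (p≢q ∷ p∉fs) =
  coprime-*ʳ (coprime-^ʳ k (distinct-primes-coprime p-prime q-prime p≢q))
             (prime-coprime-primePowerProduct p-prime primes p∉fs)

multiplicative-factorization : ∀ {f} → Multiplicative f → (g : ℕ → ℕ) → (∀ {p} k → Prime p → f (p ^ k) ≡ g k) →
                               ∀ {n fs} → IsFactorization n fs → f n ≡ product (map (g ∘ proj₂) fs)
multiplicative-factorization f-mult g f[p^k] {fs = []} (_ , _ , _ , refl) = Multiplicative.1-homo f-mult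
multiplicative-factorization {f} f-mult g f[p^k] {fs = (p , k) ∷ fs}
                             (p-prime ∷ primes , _ ∷ ks≥1 , p∉fs ∷ distinct , refl) = begin
  f (p ^ k * primePowerProduct fs)
    ≡⟨ Multiplicative.*-homo f-mult p^k⊥rest ⟩
  f (p ^ k) * f (primePowerProduct fs)
    ≡⟨ cong₂ _*_ (f[p^k] k p-prime) (multiplicative-factorization f-mult g f[p^k] (primes , ks≥1 , distinct , refl)) ⟩
  g k * product (map (g ∘ proj₂) fs)
    ∎
  where
  instance
    p^k≢0 : NonZero (p ^ k)
    p^k≢0 = m^n≢0 p k {{prime⇒nonZero p-prime}}
    rest≢0 : NonZero (primePowerProduct fs)
    rest≢0 = primePowerProduct-nonZero primes
  p^k⊥rest : Coprime (p ^ k) (primePowerProduct fs)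
  p^k⊥rest = Coprime.sym (coprime-^ʳ k (Coprime.sym (prime-coprime-primePowerProduct p-prime primes p∉fs)))

-- Prime powers

^-monoʳ-∣ : ∀ m {i k} → i ≤ k → m ^ i ∣ m ^ k
^-monoʳ-∣ m {k = k} z≤n       = 1∣ (m ^ k)
^-monoʳ-∣ m         (s≤s i≤k) = *-monoʳ-∣ m (^-monoʳ-∣ m i≤k)

∣p^k⇒≡p^i : ∀ {p d} k → Prime p → d ∣ p ^ k → ∃[ i ] i ≤ k × d ≡ p ^ i
∣p^k⇒≡p^i         zero    _       d∣1       = 0 , z≤n , ∣1⇒≡1 d∣1
∣p^k⇒≡p^i {p} {d} (suc k) p-prime d∣p^[1+k] with p ∣? d
... | yes (divides e refl) =
  let i , i≤k , e≡p^i = ∣p^k⇒≡p^i k p-prime (*-cancelʳ-∣ p (subst (e * p ∣_) (*-comm p (p ^ k)) d∣p^[1+k]))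
  in suc i , s≤s i≤k , trans (*-comm e p) (cong (p *_) e≡p^i)
  where instance _ = prime⇒nonZero p-prime
... | no p∤d =
  let i , i≤k , d≡p^i = ∣p^k⇒≡p^i k p-prime (coprime-divisor (Coprime.sym (prime∤⇒coprime p-prime p∤d)) d∣p^[1+k])
  in i , m≤n⇒m≤1+n i≤k , d≡p^i

divisors-prime^-↭ : ∀ {p} → Prime p → ∀ k → divisors (p ^ k) ↭ applyUpTo (p ^_) (suc k)
divisors-prime^-↭ {p} p-prime k = ∼bag⇒↭ (unique∧set⇒bag (divisors-unique (p ^ k)) !powers (mk⇔ to from))
  where
  instance
    p≢0   = prime⇒nonZero p-prime
    p^k≢0 = m^n≢0 p k
  !powers : Unique (applyUpTo (p ^_) (suc k))
  !powers = applyUpTo⁺₁ (p ^_) (suc k) (λ i<j _ → <⇒≢ (^-monoʳ-< p 1<p i<j))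
    where
    1<p = nonTrivial⇒n>1 p {{prime⇒nonTrivial p-prime}}
  to : ∀ {d} → d ∈ divisors (p ^ k) → d ∈ applyUpTo (p ^_) (suc k)
  to d∈ with i , i≤k , refl ← ∣p^k⇒≡p^i k p-prime (∈-divisors⁻ d∈) = ∈-applyUpTo⁺ (p ^_) (s≤s i≤k)
  from : ∀ {d} → d ∈ applyUpTo (p ^_) (suc k) → d ∈ divisors (p ^ k)
  from d∈ with i , s≤s i≤k , refl ← ∈-applyUpTo⁻ (p ^_) d∈ = ∈-divisors⁺ (^-monoʳ-∣ p i≤k)

divisorSum-prime^ : ∀ F {p} k → Prime p →
                    divisorSum F (p ^ k) ≡ F (p ^ k) 1 + ∑ (applyUpTo (λ i → p ^ suc i) k) (F (p ^ k))
divisorSum-prime^ F {p} k p-prime = ∑-↭ (divisors-prime^-↭ p-prime k) (F (p ^ k))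

∑-applyUpTo-1 : ∀ (h : ℕ → ℕ) k {f : ℕ → ℕ} → (∀ i → f (h i) ≡ 1) → ∑ (applyUpTo h k) f ≡ k
∑-applyUpTo-1 h k {f} f∘h≡1 = begin
  ∑ (applyUpTo h k) f
    ≡⟨ ∑-cong (applyUpTo h k) f≡1 ⟩
  ∑[ _ ∈ applyUpTo h k ] 1
    ≡⟨ ∑-const (applyUpTo h k) 1 ⟩
  length (applyUpTo h k) * 1
    ≡⟨ trans (*-identityʳ _) (length-applyUpTo h k) ⟩
  k
    ∎
  where
  f≡1 : ∀ {u} → u ∈ applyUpTo h k → f u ≡ 1
  f≡1 u∈ with i , _ , refl ← ∈-applyUpTo⁻ h u∈ = f∘h≡1 i

coprimeCount-prime^-p^[1+i] : ∀ {p} k → Prime p → ∀ i → coprimeCount (divisors (p ^ k)) (p ^ suc i) ≡ 1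
coprimeCount-prime^-p^[1+i] {p} k p-prime i = begin
  coprimeCount (divisors (p ^ k)) (p ^ suc i)
    ≡⟨ ∑-↭ (divisors-prime^-↭ p-prime k) (λ v → 𝟙 (does (coprime? (p ^ suc i) v))) ⟩
  𝟙 (does (coprime? (p ^ suc i) 1)) + coprimeCount powers (p ^ suc i)
    ≡⟨ cong₂ _+_ (cong 𝟙 (dec-true (coprime? (p ^ suc i) 1) (Coprime.sym (1-coprimeTo (p ^ suc i)))))
                 (∑-zero powers not-coprime) ⟩
  1
    ∎
  where
  powers = applyUpTo (λ j → p ^ suc j) k
  not-coprime : ∀ {v} → v ∈ powers → 𝟙 (does (coprime? (p ^ suc i) v)) ≡ 0
  not-coprime v∈ with j , _ , refl ← ∈-applyUpTo⁻ (λ j → p ^ suc j) v∈ =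
    cong 𝟙 (dec-false (coprime? _ _) (λ p^[1+i]⊥p^[1+j] →
      nonTrivial⇒≢1 {{prime⇒nonTrivial p-prime}} (p^[1+i]⊥p^[1+j] (m∣m*n (p ^ i) , m∣m*n (p ^ j)))))

divisorCount-prime^ : ∀ {p} k → Prime p → divisorCount (p ^ k) ≡ suc k
divisorCount-prime^ {p} k p-prime =
  trans (divisorSum-prime^ (λ _ _ → 1) k p-prime) (cong suc (∑-applyUpTo-1 (λ i → p ^ suc i) k (λ _ → refl)))

coprimeCount-prime^-1 : ∀ {p} k → Prime p → coprimeCount (divisors (p ^ k)) 1 ≡ suc k
coprimeCount-prime^-1 {p} k p-prime =
  trans (coprimeCount-1 (divisors (p ^ k))) (trans (length-divisors (p ^ k)) (divisorCount-prime^ k p-prime))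

coprimePairCount-prime^ : ∀ {p} k → Prime p → coprimePairCount (p ^ k) ≡ 2 * k + 1
coprimePairCount-prime^ {p} k p-prime = begin
  coprimePairCount (p ^ k)
    ≡⟨ divisorSum-prime^ (coprimeCount ∘ divisors) k p-prime ⟩
  coprimeCount (divisors (p ^ k)) 1 + ∑ (applyUpTo (λ i → p ^ suc i) k) (coprimeCount (divisors (p ^ k)))
    ≡⟨ cong₂ _+_ (coprimeCount-prime^-1 k p-prime)
                 (∑-applyUpTo-1 (λ i → p ^ suc i) k (coprimeCount-prime^-p^[1+i] k p-prime)) ⟩
  suc k + k
    ≡⟨ regroup k ⟩
  2 * k + 1
    ∎
  where
  regroup : ∀ k → suc k + k ≡ 2 * k + 1
  regroup = solve-∀

coprimeTripleCount-prime^ : ∀ {p} k → Prime p → coprimeTripleCount (p ^ k) ≡ suc k * suc k + k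
coprimeTripleCount-prime^ {p} k p-prime = trans
  (divisorSum-prime^ (λ n u → coprimeCount (divisors n) u * coprimeCount (divisors n) u) k p-prime)
  (cong₂ _+_ (cong (λ t → t * t) (coprimeCount-prime^-1 k p-prime))
             (∑-applyUpTo-1 (λ i → p ^ suc i) k (λ i → cong (λ t → t * t) (coprimeCount-prime^-p^[1+i] k p-prime i))))

-- The Schultz index

schultz-arithmetic : ∀ {S Q T N A B} → 1 ≤ N → S + Q + 2 * T ≡ 2 * N * T → T + 1 ≡ A → Q + 2 * N ≡ B + 1 →
                     S + B ≡ 2 * (N ∸ 1) * A + 1
schultz-arithmetic {S} {Q} {T} {suc D} {B = B} (s≤s z≤n) eq₁ refl eq₃ =
  +-cancelʳ-≡ (1 + 2 * T) (S + B) (2 * D * (T + 1) + 1) (begin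
    S + B + (1 + 2 * T)               ≡⟨ regroup₁ S B T ⟩
    S + 2 * T + (B + 1)               ≡⟨ cong (S + 2 * T +_) eq₃ ⟨
    S + 2 * T + (Q + 2 * suc D)       ≡⟨ regroup₂ S T Q (suc D) ⟩
    S + Q + 2 * T + 2 * suc D         ≡⟨ cong (_+ 2 * suc D) eq₁ ⟩
    2 * suc D * T + 2 * suc D         ≡⟨ regroup₃ D T ⟩
    2 * D * (T + 1) + 1 + (1 + 2 * T) ∎)
  where
  regroup₁ : ∀ s b t → s + b + (1 + 2 * t) ≡ s + 2 * t + (b + 1)
  regroup₁ = solve-∀
  regroup₂ : ∀ s t q n → s + 2 * t + (q + 2 * n) ≡ s + q + 2 * t + 2 * n
  regroup₂ = solve-∀
  regroup₃ : ∀ d t → 2 * suc d * t + 2 * suc d ≡ 2 * d * (t + 1) + 1 + (1 + 2 * t)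
  regroup₃ = solve-∀

schultz-formula : ∀ n .{{_ : NonZero n}} →
                  schultz n + coprimeTripleCount n ≡ 2 * (length (divisors n) ∸ 1) * coprimePairCount n + 1
schultz-formula n = schultz-arithmetic (nonempty 1∈V)
  (trans (cong (λ s → s + ∑[ u ∈ V ] (degree V u * degree V u) + 2 * ∑ V (degree V))
               (schultz≡∑degree*transmission n 1∈V))
         (∑degree*transmission+∑degree² !V 1∈V))
  (∑degree+1≡∑coprimeCount !V 1∈V)
  (∑degree²+2|V|≡∑coprimeCount²+1 !V 1∈V)
  where
  V = divisors n
  !V = divisors-unique n
  1∈V = ∈-divisors⁺ (1∣ n)
  nonempty : ∀ {xs : List ℕ} {x} → x ∈ xs → 1 ≤ length xs
  nonempty {_ ∷ _} _ = s≤s z≤n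

-- Imported only here: the prefix +_ of Data.Integer makes sections such as (a +_) above ambiguous.
open import Data.Integer using (ℤ; +_; _-_)
import Data.Integer.Properties as ℤ
open import Data.Integer.Tactic.RingSolver using () renaming (solve-∀ to ℤ-solve-∀)

m+n≡o+1⇒+m≡+o-+n+1 : ∀ {m n o} → m + n ≡ o + 1 → + m ≡ (+ o - + n) Data.Integer.+ + 1
m+n≡o+1⇒+m≡+o-+n+1 {m} {n} {o} m+n≡o+1 = begin
  + m                                ≡⟨ add-sub (+ m) (+ n) ⟩
  (+ m Data.Integer.+ + n) - + n     ≡⟨ cong (_- + n) (ℤ.pos-+ m n) ⟨
  + (m + n) - + n                    ≡⟨ cong (λ t → + t - + n) m+n≡o+1 ⟩
  + (o + 1) - + n                    ≡⟨ cong (_- + n) (ℤ.pos-+ o 1) ⟩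
  (+ o Data.Integer.+ + 1) - + n     ≡⟨ sub-swap (+ o) (+ 1) (+ n) ⟩
  (+ o - + n) Data.Integer.+ + 1     ∎
  where
  add-sub : ∀ (i j : ℤ) → i ≡ (i Data.Integer.+ j) - j
  add-sub = ℤ-solve-∀
  sub-swap : ∀ (i j k : ℤ) → (i Data.Integer.+ j) - k ≡ (i - k) Data.Integer.+ j
  sub-swap = ℤ-solve-∀

theorem3p6 : (n : ℕ) (fs : List (ℕ × ℕ)) → IsFactorization n fs →
    + schultz n ≡
      (+ (2 * (product (map (λ pk → suc (proj₂ pk)) fs) ∸ 1)
            * product (map (λ pk → 2 * proj₂ pk + 1) fs))
        - + product (map (λ pk → suc (proj₂ pk) * suc (proj₂ pk) + proj₂ pk) fs))
      Data.Integer.+ + 1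
theorem3p6 n fs fac@(primes , _ , _ , n≡∏) = m+n≡o+1⇒+m≡+o-+n+1 (begin
  schultz n + product (map (λ pk → suc (proj₂ pk) * suc (proj₂ pk) + proj₂ pk) fs)
    ≡⟨ cong (λ b → schultz n + b) (on-factorization coprimeTripleCount-multiplicative coprimeTripleCount-prime^) ⟨
  schultz n + coprimeTripleCount n
    ≡⟨ schultz-formula n ⟩
  2 * (length (divisors n) ∸ 1) * coprimePairCount n + 1
    ≡⟨ cong₂ (λ d a → 2 * (d ∸ 1) * a + 1)
             (trans (length-divisors n) (on-factorization divisorCount-multiplicative divisorCount-prime^))
             (on-factorization coprimePairCount-multiplicative coprimePairCount-prime^) ⟩
  2 * (product (map (λ pk → suc (proj₂ pk)) fs) ∸ 1) * product (map (λ pk → 2 * proj₂ pk + 1) fs) + 1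
    ∎)
  where
  instance
    n≢0 : NonZero n
    n≢0 = subst NonZero (sym n≡∏) (primePowerProduct-nonZero primes)
  on-factorization : ∀ {f g} → Multiplicative f → (∀ {p} k → Prime p → f (p ^ k) ≡ g k) →
                     f n ≡ product (map (g ∘ proj₂) fs)
  on-factorization {g = g} f-mult f[p^k] = multiplicative-factorization f-mult g f[p^k] fac
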